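{- For all graphs $A,A',B$, $W(A*B,A'*B)\ge W(A,A')$.
   Context: Graphs are finite, simple, undirected, loopless. The join $A*B$ is obtained from the vertex-disjoint union of $A$ and $B$ by adding all edges between a vertex of $A$ and a vertex of $B$. First-order sentences about graphs use only adjacency $\sim$ and equality $=$. For graphs $G,H$, $W(G,H)$ is the minimum number of distinct variables in a first-order sentence true on one of $G,H$ and false on the other ($\infty$ if no such sentence exists). -}

module Defs where

open import Data.Nat using (ℕ; _≤_)
open import Data.Fin using (Fin; zero; suc; splitAt; _≟_)
open import Data.Bool using (Bool; true; false; not; _∧_; _∨_)
open import Data.Maybe using (Maybe; just; nothing)
open import Data.Sum using (_⊎_; inj₁; inj₂)
open import Data.Product using (_×_; Σ; _,_)
open import Data.Empty using (⊥)
open import Relation.Nullary using (¬_; does)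
open import Relation.Binary.PropositionalEquality using (_≡_; _≢_; refl)

record Graph : Set where
  field
    n      : ℕ
    adj    : Fin n → Fin n → Bool
    sym    : ∀ x y → adj x y ≡ adj y x
    irrefl : ∀ x → adj x x ≡ false

open Graph public

module _ (A B : Graph) where
  joinAdjS : Fin (n A) ⊎ Fin (n B) → Fin (n A) ⊎ Fin (n B) → Bool
  joinAdjS (inj₁ a) (inj₁ a') = adj A a a'
  joinAdjS (inj₂ b) (inj₂ b') = adj B b b'
  joinAdjS (inj₁ _) (inj₂ _)  = true
  joinAdjS (inj₂ _) (inj₁ _)  = true

  joinAdjS-sym : ∀ u v → joinAdjS u v ≡ joinAdjS v u
  joinAdjS-sym (inj₁ a) (inj₁ a') = sym A a a'
  joinAdjS-sym (inj₂ b) (inj₂ b') = sym B b b'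
  joinAdjS-sym (inj₁ _) (inj₂ _)  = refl
  joinAdjS-sym (inj₂ _) (inj₁ _)  = refl

  joinAdjS-irrefl : ∀ u → joinAdjS u u ≡ false
  joinAdjS-irrefl (inj₁ a) = irrefl A a
  joinAdjS-irrefl (inj₂ b) = irrefl B b

infixl 7 _⋆_
_⋆_ : Graph → Graph → Graph
A ⋆ B = record
  { n      = Data.Nat._+_ (n A) (n B)
  ; adj    = λ x y → joinAdjS A B (splitAt (n A) x) (splitAt (n A) y)
  ; sym    = λ x y → joinAdjS-sym A B (splitAt (n A) x) (splitAt (n A) y)
  ; irrefl = λ x → joinAdjS-irrefl A B (splitAt (n A) x)
  }

-- First-order formulas in the language {∼, =} whose variables are
-- drawn from the k variables Fin k (variables may be re-used/re-quantified).

data Formula (k : ℕ) : Set where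
  adjF : Fin k → Fin k → Formula k
  eqF  : Fin k → Fin k → Formula k
  ¬F   : Formula k → Formula k
  _∧F_ : Formula k → Formula k → Formula k
  _∨F_ : Formula k → Formula k → Formula k
  ∃F   : Fin k → Formula k → Formula k
  ∀F   : Fin k → Formula k → Formula k

data Free {k : ℕ} (x : Fin k) : Formula k → Set where
  adjˡ : ∀ {y} → Free x (adjF x y)
  adjʳ : ∀ {y} → Free x (adjF y x)
  eqˡ  : ∀ {y} → Free x (eqF x y)
  eqʳ  : ∀ {y} → Free x (eqF y x)
  neg  : ∀ {φ} → Free x φ → Free x (¬F φ)
  andˡ : ∀ {φ ψ} → Free x φ → Free x (φ ∧F ψ)
  andʳ : ∀ {φ ψ} → Free x ψ → Free x (φ ∧F ψ)
  orˡ  : ∀ {φ ψ} → Free x φ → Free x (φ ∨F ψ)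
  orʳ  : ∀ {φ ψ} → Free x ψ → Free x (φ ∨F ψ)
  ex   : ∀ {y φ} → x ≢ y → Free x φ → Free x (∃F y φ)
  all  : ∀ {y φ} → x ≢ y → Free x φ → Free x (∀F y φ)

Sentence : {k : ℕ} → Formula k → Set
Sentence φ = ∀ x → ¬ Free x φ

anyFin : ∀ {m} → (Fin m → Bool) → Bool
anyFin {ℕ.zero}  f = false
anyFin {ℕ.suc m} f = f zero ∨ anyFin (λ i → f (suc i))

allFin : ∀ {m} → (Fin m → Bool) → Bool
allFin {ℕ.zero}  f = true
allFin {ℕ.suc m} f = f zero ∧ allFin (λ i → f (suc i))

-- Semantics under a partial assignment (unassigned variables only matter
-- for non-sentences; atoms mentioning them evaluate to false).
update : ∀ {k} {V : Set} → (Fin k → Maybe V) → Fin k → V → (Fin k → Maybe V)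
update ρ x v y with does (x ≟ y)
... | true  = just v
... | false = ρ y

eval : (G : Graph) {k : ℕ} → Formula k → (Fin k → Maybe (Fin (n G))) → Bool
eval G (adjF x y) ρ with ρ x | ρ y
... | just u | just v = adj G u v
... | _      | _      = false
eval G (eqF x y) ρ with ρ x | ρ y
... | just u | just v = does (u ≟ v)
... | _      | _      = false
eval G (¬F φ)   ρ = not (eval G φ ρ)
eval G (φ ∧F ψ) ρ = eval G φ ρ ∧ eval G ψ ρ
eval G (φ ∨F ψ) ρ = eval G φ ρ ∨ eval G ψ ρ
eval G (∃F x φ) ρ = anyFin (λ v → eval G φ (update ρ x v))
eval G (∀F x φ) ρ = allFin (λ v → eval G φ (update ρ x v))

_⊨_ : (G : Graph) {k : ℕ} → Formula k → Bool
G ⊨ φ = eval G φ (λ _ → nothing)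

Distinguishable : ℕ → Graph → Graph → Set
Distinguishable k G H =
  Σ (Formula k) λ φ → Sentence φ × ((G ⊨ φ) ≢ (H ⊨ φ))

-- W(G,H) ∈ ℕ ∪ {∞}: the minimum number of variables of a distinguishing
-- sentence, ∞ if none.

data ℕ∞ : Set where
  fin : ℕ → ℕ∞
  ∞   : ℕ∞

data _≤∞_ : ℕ∞ → ℕ∞ → Set where
  fin≤fin : ∀ {a b} → a ≤ b → fin a ≤∞ fin b
  _≤∞∞    : ∀ a → a ≤∞ ∞

IsW : Graph → Graph → ℕ∞ → Set
IsW G H (fin m) = Distinguishable m G H × (∀ k → Distinguishable k G H → m ≤ k)
IsW G H ∞       = ∀ k → ¬ Distinguishable k G H

-- Fix B. A formula about A ⋆ B can be rewritten as a formula about A with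
-- the same variables, uniformly in A: a quantifier ∃x over A ⋆ B becomes ∃x
-- over A together with a finite disjunction over the vertices b of B, in
-- which x stands for b. Atoms involving a variable that stands for a vertex
-- of B have a truth value known in advance (every A-vertex is adjacent to
-- every B-vertex and different from it), so they become constants. Hence a
-- k-variable sentence distinguishing A ⋆ B from A' ⋆ B is turned into a
-- k-variable sentence distinguishing A from A'.
module Submission where

open import Defs hiding (sym)
open import Data.Nat using (ℕ; zero; suc; _+_)
open import Data.Fin using (Fin; zero; suc; splitAt; join; _≟_; _↑ˡ_; _↑ʳ_)
open import Data.Fin.Properties using (splitAt-↑ˡ; splitAt-↑ʳ; join-splitAt)
open import Data.Bool using (Bool; true; false; not; _∧_; _∨_)
open import Data.Bool.Properties using (∨-inverseʳ; ∨-assoc; ∧-assoc)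
open import Data.Maybe using (Maybe; just; nothing)
open import Data.Sum using (_⊎_; inj₁; inj₂)
open import Data.Sum.Properties using (≡-dec)
open import Data.Product using (_×_; Σ; _,_)
open import Data.Empty using (⊥-elim)
open import Function.Bundles using (_⇔_; mk⇔)
open import Relation.Nullary using (¬_; does; yes; no)
open import Relation.Nullary.Decidable using (does-⇔)
open import Relation.Binary.PropositionalEquality
  using (_≡_; _≢_; refl; sym; trans; cong; cong₂; module ≡-Reasoning)

_≡ᵇ_ : ∀ {m} → Fin m → Fin m → Bool
i ≡ᵇ j = does (i ≟ j)

liftRel : {V : Set} → (V → V → Bool) → Maybe V → Maybe V → Bool
liftRel R (just u) (just v) = R u v
liftRel R _        _        = false

sumRel : {X Y : Set} → (X → X → Bool) → Bool → (Y → Y → Bool) → X ⊎ Y → X ⊎ Y → Bool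
sumRel R c S (inj₁ x) (inj₁ x') = R x x'
sumRel R c S (inj₂ y) (inj₂ y') = S y y'
sumRel R c S _        _         = c

eval-adjF : ∀ G {k} (x y : Fin k) ρ → eval G (adjF x y) ρ ≡ liftRel (adj G) (ρ x) (ρ y)
eval-adjF G x y ρ with ρ x | ρ y
... | just _  | just _  = refl
... | just _  | nothing = refl
... | nothing | _       = refl

eval-eqF : ∀ G {k} (x y : Fin k) ρ → eval G (eqF x y) ρ ≡ liftRel _≡ᵇ_ (ρ x) (ρ y)
eval-eqF G x y ρ with ρ x | ρ y
... | just _  | just _  = refl
... | just _  | nothing = refl
... | nothing | _       = refl

free-adjF : ∀ {k} {x y z : Fin k} → Free z (adjF x y) → z ≡ x ⊎ z ≡ y
free-adjF adjˡ = inj₁ refl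
free-adjF adjʳ = inj₂ refl

free-eqF : ∀ {k} {x y z : Fin k} → Free z (eqF x y) → z ≡ x ⊎ z ≡ y
free-eqF eqˡ = inj₁ refl
free-eqF eqʳ = inj₂ refl

adj-⋆ : ∀ A B (v w : Fin (n (A ⋆ B))) →
        adj (A ⋆ B) v w ≡ sumRel (adj A) true (adj B) (splitAt (n A) v) (splitAt (n A) w)
adj-⋆ A B v w = joinAdjS-sumRel (splitAt (n A) v) (splitAt (n A) w)
  where
  joinAdjS-sumRel : ∀ u u' → joinAdjS A B u u' ≡ sumRel (adj A) true (adj B) u u'
  joinAdjS-sumRel (inj₁ _) (inj₁ _) = refl
  joinAdjS-sumRel (inj₁ _) (inj₂ _) = refl
  joinAdjS-sumRel (inj₂ _) (inj₁ _) = refl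
  joinAdjS-sumRel (inj₂ _) (inj₂ _) = refl

≡ᵇ-splitAt : ∀ m {p} (v w : Fin (m + p)) →
             v ≡ᵇ w ≡ sumRel _≡ᵇ_ false _≡ᵇ_ (splitAt m v) (splitAt m w)
≡ᵇ-splitAt m {p} v w =
  trans (does-⇔ splitAt-⇔ (v ≟ w) (≡-dec _≟_ _≟_ (splitAt m v) (splitAt m w)))
        (≡-dec-sumRel (splitAt m v) (splitAt m w))
  where
  splitAt-⇔ : v ≡ w ⇔ splitAt m v ≡ splitAt m w
  splitAt-⇔ = mk⇔ (cong (splitAt m)) λ e → begin
    v                        ≡⟨ sym (join-splitAt m p v) ⟩
    join m p (splitAt m v)   ≡⟨ cong (join m p) e ⟩
    join m p (splitAt m w)   ≡⟨ join-splitAt m p w ⟩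
    w                        ∎
    where open ≡-Reasoning

  ≡-dec-sumRel : ∀ u u' → does (≡-dec _≟_ _≟_ u u') ≡ sumRel _≡ᵇ_ false _≡ᵇ_ u u'
  ≡-dec-sumRel (inj₁ _) (inj₁ _) = refl
  ≡-dec-sumRel (inj₁ _) (inj₂ _) = refl
  ≡-dec-sumRel (inj₂ _) (inj₁ _) = refl
  ≡-dec-sumRel (inj₂ _) (inj₂ _) = refl

anyFin-cong : ∀ {m} {f g : Fin m → Bool} → (∀ i → f i ≡ g i) → anyFin f ≡ anyFin g
anyFin-cong {zero}  h = refl
anyFin-cong {suc m} h = cong₂ _∨_ (h zero) (anyFin-cong (λ i → h (suc i)))

allFin-cong : ∀ {m} {f g : Fin m → Bool} → (∀ i → f i ≡ g i) → allFin f ≡ allFin g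
allFin-cong {zero}  h = refl
allFin-cong {suc m} h = cong₂ _∧_ (h zero) (allFin-cong (λ i → h (suc i)))

anyFin-+ : ∀ m p (f : Fin (m + p) → Bool) →
           anyFin f ≡ anyFin (λ i → f (i ↑ˡ p)) ∨ anyFin (λ j → f (m ↑ʳ j))
anyFin-+ zero    p f = refl
anyFin-+ (suc m) p f =
  trans (cong (f zero ∨_) (anyFin-+ m p (λ i → f (suc i)))) (sym (∨-assoc (f zero) _ _))

allFin-+ : ∀ m p (f : Fin (m + p) → Bool) →
           allFin f ≡ allFin (λ i → f (i ↑ˡ p)) ∧ allFin (λ j → f (m ↑ʳ j))
allFin-+ zero    p f = refl
allFin-+ (suc m) p f =
  trans (cong (f zero ∧_) (allFin-+ m p (λ i → f (suc i)))) (sym (∧-assoc (f zero) _ _))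

¬Formula0 : ¬ Formula 0
¬Formula0 (adjF () _)
¬Formula0 (eqF () _)
¬Formula0 (¬F φ)   = ¬Formula0 φ
¬Formula0 (φ ∧F _) = ¬Formula0 φ
¬Formula0 (φ ∨F _) = ¬Formula0 φ
¬Formula0 (∃F () _)
¬Formula0 (∀F () _)

module _ {k : ℕ} where

  reflexivityF : Formula (suc k)
  reflexivityF = ∀F zero (eqF zero zero)

  ⊤F : Formula (suc k)
  ⊤F = reflexivityF ∨F ¬F reflexivityF

  constF : Bool → Formula (suc k)
  constF true  = ⊤F
  constF false = ¬F ⊤F

  eval-constF : ∀ G b ρ → eval G (constF b) ρ ≡ b
  eval-constF G true  ρ = ∨-inverseʳ (eval G reflexivityF ρ)
  eval-constF G false ρ = cong not (∨-inverseʳ (eval G reflexivityF ρ))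

  closed-constF : ∀ b {x} → ¬ Free x (constF b)
  closed-constF true  (orˡ (all x≢0 eqˡ))       = x≢0 refl
  closed-constF true  (orˡ (all x≢0 eqʳ))       = x≢0 refl
  closed-constF true  (orʳ (neg (all x≢0 eqˡ))) = x≢0 refl
  closed-constF true  (orʳ (neg (all x≢0 eqʳ))) = x≢0 refl
  closed-constF false (neg fr)                  = closed-constF true fr

  ⋁F : ∀ {m} → (Fin m → Formula (suc k)) → Formula (suc k)
  ⋁F {zero}  f = constF false
  ⋁F {suc m} f = f zero ∨F ⋁F (λ i → f (suc i))

  ⋀F : ∀ {m} → (Fin m → Formula (suc k)) → Formula (suc k)
  ⋀F {zero}  f = constF true
  ⋀F {suc m} f = f zero ∧F ⋀F (λ i → f (suc i))

  eval-⋁F : ∀ G {m} (f : Fin m → Formula (suc k)) ρ →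
            eval G (⋁F f) ρ ≡ anyFin (λ i → eval G (f i) ρ)
  eval-⋁F G {zero}  f ρ = eval-constF G false ρ
  eval-⋁F G {suc m} f ρ = cong (eval G (f zero) ρ ∨_) (eval-⋁F G (λ i → f (suc i)) ρ)

  eval-⋀F : ∀ G {m} (f : Fin m → Formula (suc k)) ρ →
            eval G (⋀F f) ρ ≡ allFin (λ i → eval G (f i) ρ)
  eval-⋀F G {zero}  f ρ = eval-constF G true ρ
  eval-⋀F G {suc m} f ρ = cong (eval G (f zero) ρ ∧_) (eval-⋀F G (λ i → f (suc i)) ρ)

  free-⋁F : ∀ {m} (f : Fin m → Formula (suc k)) {x} →
            Free x (⋁F f) → Σ (Fin m) λ i → Free x (f i)
  free-⋁F {zero}  f fr        = ⊥-elim (closed-constF false fr)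
  free-⋁F {suc m} f (orˡ fr) = zero , fr
  free-⋁F {suc m} f (orʳ fr) with free-⋁F (λ i → f (suc i)) fr
  ... | i , fr' = suc i , fr'

  free-⋀F : ∀ {m} (f : Fin m → Formula (suc k)) {x} →
            Free x (⋀F f) → Σ (Fin m) λ i → Free x (f i)
  free-⋀F {zero}  f fr         = ⊥-elim (closed-constF true fr)
  free-⋀F {suc m} f (andˡ fr) = zero , fr
  free-⋀F {suc m} f (andʳ fr) with free-⋀F (λ i → f (suc i)) fr
  ... | i , fr' = suc i , fr'

data Place (m : ℕ) : Set where
  unassigned inA : Place m
  inB            : Fin m → Place m

updatePlace : ∀ {k m} → (Fin k → Place m) → Fin k → Place m → (Fin k → Place m)
updatePlace π x l y with does (x ≟ y)
... | true  = l
... | false = π y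

-- Value of an atom over A ⋆ B whose two variables are placed at the given
-- places: a when both lie in A, c across the join, S inside B.
placedValue : ∀ {m} → Bool → Bool → (Fin m → Fin m → Bool) → Place m → Place m → Bool
placedValue a c S inA     inA      = a
placedValue a c S inA     (inB _)  = c
placedValue a c S (inB _) inA      = c
placedValue a c S (inB b) (inB b') = S b b'
placedValue a c S _       _        = false

module Translation (B : Graph) {k : ℕ} where

  Placement : Set
  Placement = Fin (suc k) → Place (n B)

  atom : (Fin (suc k) → Fin (suc k) → Formula (suc k)) → Bool → (Fin (n B) → Fin (n B) → Bool) →
         Place (n B) → Place (n B) → Fin (suc k) → Fin (suc k) → Formula (suc k)
  atom F c S inA     inA      x y = F x y
  atom F c S inA     (inB _)  x y = constF c
  atom F c S (inB _) inA      x y = constF c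
  atom F c S (inB b) (inB b') x y = constF (S b b')
  atom F c S _       _        x y = constF false

  translate : Formula (suc k) → Placement → Formula (suc k)
  translate (adjF x y) π = atom adjF true  (adj B) (π x) (π y) x y
  translate (eqF x y)  π = atom eqF  false _≡ᵇ_    (π x) (π y) x y
  translate (¬F φ)     π = ¬F (translate φ π)
  translate (φ ∧F ψ)   π = translate φ π ∧F translate ψ π
  translate (φ ∨F ψ)   π = translate φ π ∨F translate ψ π
  translate (∃F x φ)   π = ∃F x (translate φ (updatePlace π x inA))
                           ∨F ⋁F (λ b → translate φ (updatePlace π x (inB b)))
  translate (∀F x φ)   π = ∀F x (translate φ (updatePlace π x inA))
                           ∧F ⋀F (λ b → translate φ (updatePlace π x (inB b)))

  eval-atom : ∀ A F c S l l' x y ρ →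
              eval A (atom F c S l l' x y) ρ ≡ placedValue (eval A (F x y) ρ) c S l l'
  eval-atom A F c S inA        inA        x y ρ = refl
  eval-atom A F c S inA        (inB _)    x y ρ = eval-constF A c ρ
  eval-atom A F c S (inB _)    inA        x y ρ = eval-constF A c ρ
  eval-atom A F c S (inB b)    (inB b')   x y ρ = eval-constF A (S b b') ρ
  eval-atom A F c S inA        unassigned x y ρ = eval-constF A false ρ
  eval-atom A F c S (inB _)    unassigned x y ρ = eval-constF A false ρ
  eval-atom A F c S unassigned _          x y ρ = eval-constF A false ρ

  free-atom : ∀ F c S l l' x y {z} →
              Free z (atom F c S l l' x y) → l ≡ inA × l' ≡ inA × Free z (F x y)
  free-atom F c S inA        inA        x y fr = refl , refl , fr
  free-atom F c S inA        (inB _)    x y fr = ⊥-elim (closed-constF c fr)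
  free-atom F c S (inB _)    inA        x y fr = ⊥-elim (closed-constF c fr)
  free-atom F c S (inB b)    (inB b')   x y fr = ⊥-elim (closed-constF (S b b') fr)
  free-atom F c S inA        unassigned x y fr = ⊥-elim (closed-constF false fr)
  free-atom F c S (inB _)    unassigned x y fr = ⊥-elim (closed-constF false fr)
  free-atom F c S unassigned _          x y fr = ⊥-elim (closed-constF false fr)

  private
    placed-endpoint : ∀ (π : Placement) {x y z} →
                      π x ≡ inA → π y ≡ inA → z ≡ x ⊎ z ≡ y → π z ≡ inA
    placed-endpoint π πx πy (inj₁ refl) = πx
    placed-endpoint π πx πy (inj₂ refl) = πy

    updatePlace-other : ∀ (π : Placement) x l {z} → z ≢ x → updatePlace π x l z ≡ π z
    updatePlace-other π x l {z} z≢x with x ≟ z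
    ... | yes refl = ⊥-elim (z≢x refl)
    ... | no _     = refl

    updatePlace-inB : ∀ (π : Placement) x b {z} → updatePlace π x (inB b) z ≡ inA → π z ≡ inA
    updatePlace-inB π x b {z} e with x ≟ z
    updatePlace-inB π x b () | yes refl
    ... | no _ = e

  free-translate : ∀ φ π {z} → Free z (translate φ π) → π z ≡ inA
  free-translate (adjF x y) π fr with free-atom adjF true (adj B) (π x) (π y) x y fr
  ... | πx , πy , fr' = placed-endpoint π πx πy (free-adjF fr')
  free-translate (eqF x y)  π fr with free-atom eqF false _≡ᵇ_ (π x) (π y) x y fr
  ... | πx , πy , fr' = placed-endpoint π πx πy (free-eqF fr')
  free-translate (¬F φ)     π (neg fr)  = free-translate φ π fr
  free-translate (φ ∧F ψ)   π (andˡ fr) = free-translate φ π fr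
  free-translate (φ ∧F ψ)   π (andʳ fr) = free-translate ψ π fr
  free-translate (φ ∨F ψ)   π (orˡ fr)  = free-translate φ π fr
  free-translate (φ ∨F ψ)   π (orʳ fr)  = free-translate ψ π fr
  free-translate (∃F x φ)   π (orˡ (ex z≢x fr)) =
    trans (sym (updatePlace-other π x inA z≢x)) (free-translate φ _ fr)
  free-translate (∃F x φ)   π (orʳ fr)
    with free-⋁F (λ b → translate φ (updatePlace π x (inB b))) fr
  ... | b , fr' = updatePlace-inB π x b (free-translate φ _ fr')
  free-translate (∀F x φ)   π (andˡ (all z≢x fr)) =
    trans (sym (updatePlace-other π x inA z≢x)) (free-translate φ _ fr)
  free-translate (∀F x φ)   π (andʳ fr)
    with free-⋀F (λ b → translate φ (updatePlace π x (inB b))) fr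
  ... | b , fr' = updatePlace-inB π x b (free-translate φ _ fr')

  unplaced : Placement
  unplaced _ = unassigned

  sentence-translate : ∀ φ → Sentence (translate φ unplaced)
  sentence-translate φ z fr with free-translate φ unplaced fr
  ... | ()

module Correctness (A B : Graph) {k : ℕ} where
  open Translation B {k}

  data Matches : Maybe (Fin (n (A ⋆ B))) → Place (n B) → Maybe (Fin (n A)) → Set where
    at-unassigned : ∀ {ma} → Matches nothing unassigned ma
    at-inA        : ∀ {v a} → splitAt (n A) v ≡ inj₁ a → Matches (just v) inA (just a)
    at-inB        : ∀ {v b ma} → splitAt (n A) v ≡ inj₂ b → Matches (just v) (inB b) ma

  Assignment : Graph → Set
  Assignment G = Fin (suc k) → Maybe (Fin (n G))

  Matching : Assignment (A ⋆ B) → Placement → Assignment A → Set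
  Matching ρ π ρA = ∀ y → Matches (ρ y) (π y) (ρA y)

  matching-inA : ∀ {ρ π ρA} → Matching ρ π ρA → ∀ x a →
                 Matching (update ρ x (a ↑ˡ n B)) (updatePlace π x inA) (update ρA x a)
  matching-inA m x a y with does (x ≟ y)
  ... | true  = at-inA (splitAt-↑ˡ (n A) a (n B))
  ... | false = m y

  matching-inB : ∀ {ρ π ρA} → Matching ρ π ρA → ∀ x b →
                 Matching (update ρ x (n A ↑ʳ b)) (updatePlace π x (inB b)) ρA
  matching-inB m x b y with does (x ≟ y)
  ... | true  = at-inB (splitAt-↑ʳ (n A) (n B) b)
  ... | false = m y

  liftRel-placed : ∀ (R : Fin (n (A ⋆ B)) → Fin (n (A ⋆ B)) → Bool) RA c S →
                   (∀ v w → R v w ≡ sumRel RA c S (splitAt (n A) v) (splitAt (n A) w)) →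
                   ∀ {mv l ma mw l' mb} → Matches mv l ma → Matches mw l' mb →
                   liftRel R mv mw ≡ placedValue (liftRel RA ma mb) c S l l'
  liftRel-placed R RA c S split at-unassigned _             = refl
  liftRel-placed R RA c S split (at-inA _)    at-unassigned = refl
  liftRel-placed R RA c S split (at-inB _)    at-unassigned = refl
  liftRel-placed R RA c S split (at-inA p)    (at-inA q)    = trans (split _ _) (cong₂ (sumRel RA c S) p q)
  liftRel-placed R RA c S split (at-inA p)    (at-inB q)    = trans (split _ _) (cong₂ (sumRel RA c S) p q)
  liftRel-placed R RA c S split (at-inB p)    (at-inA q)    = trans (split _ _) (cong₂ (sumRel RA c S) p q)
  liftRel-placed R RA c S split (at-inB p)    (at-inB q)    = trans (split _ _) (cong₂ (sumRel RA c S) p q)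

  eval-translate-atom :
    ∀ F (rel : (G : Graph) → Fin (n G) → Fin (n G) → Bool) c S →
    (∀ G (x y : Fin (suc k)) ρ → eval G (F x y) ρ ≡ liftRel (rel G) (ρ x) (ρ y)) →
    (∀ v w → rel (A ⋆ B) v w ≡ sumRel (rel A) c S (splitAt (n A) v) (splitAt (n A) w)) →
    ∀ x y {ρ π ρA} → Matching ρ π ρA →
    eval (A ⋆ B) (F x y) ρ ≡ eval A (atom F c S (π x) (π y) x y) ρA
  eval-translate-atom F rel c S eval-F rel-split x y {ρ} {π} {ρA} m = begin
    eval (A ⋆ B) (F x y) ρ
      ≡⟨ eval-F (A ⋆ B) x y ρ ⟩
    liftRel (rel (A ⋆ B)) (ρ x) (ρ y)
      ≡⟨ liftRel-placed (rel (A ⋆ B)) (rel A) c S rel-split (m x) (m y) ⟩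
    placedValue (liftRel (rel A) (ρA x) (ρA y)) c S (π x) (π y)
      ≡⟨ cong (λ a → placedValue a c S (π x) (π y)) (eval-F A x y ρA) ⟨
    placedValue (eval A (F x y) ρA) c S (π x) (π y)
      ≡⟨ eval-atom A F c S (π x) (π y) x y ρA ⟨
    eval A (atom F c S (π x) (π y) x y) ρA ∎
    where open ≡-Reasoning

  eval-translate : ∀ φ {ρ π ρA} → Matching ρ π ρA → eval (A ⋆ B) φ ρ ≡ eval A (translate φ π) ρA
  eval-translate (adjF x y) m =
    eval-translate-atom adjF adj true (adj B) (λ G → eval-adjF G) (adj-⋆ A B) x y m
  eval-translate (eqF x y) m =
    eval-translate-atom eqF (λ _ → _≡ᵇ_) false _≡ᵇ_ (λ G → eval-eqF G) (≡ᵇ-splitAt (n A)) x y m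
  eval-translate (¬F φ)   m = cong not (eval-translate φ m)
  eval-translate (φ ∧F ψ) m = cong₂ _∧_ (eval-translate φ m) (eval-translate ψ m)
  eval-translate (φ ∨F ψ) m = cong₂ _∨_ (eval-translate φ m) (eval-translate ψ m)
  eval-translate (∃F x φ) {π = π} {ρA} m =
    trans (anyFin-+ (n A) (n B) _)
          (cong₂ _∨_ (anyFin-cong λ a → eval-translate φ (matching-inA m x a))
                     (trans (anyFin-cong λ b → eval-translate φ (matching-inB m x b))
                            (sym (eval-⋁F A (λ b → translate φ (updatePlace π x (inB b))) ρA))))
  eval-translate (∀F x φ) {π = π} {ρA} m =
    trans (allFin-+ (n A) (n B) _)
          (cong₂ _∧_ (allFin-cong λ a → eval-translate φ (matching-inA m x a))
                     (trans (allFin-cong λ b → eval-translate φ (matching-inB m x b))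
                            (sym (eval-⋀F A (λ b → translate φ (updatePlace π x (inB b))) ρA))))

  ⊨-translate : ∀ φ → (A ⋆ B) ⊨ φ ≡ A ⊨ translate φ unplaced
  ⊨-translate φ = eval-translate φ (λ _ → at-unassigned)

distinguishable-⋆ : ∀ A A' B k → Distinguishable k (A ⋆ B) (A' ⋆ B) → Distinguishable k A A'
distinguishable-⋆ A A' B zero    (φ , _) = ⊥-elim (¬Formula0 φ)
distinguishable-⋆ A A' B (suc k) (φ , _ , ⊨-differs) =
  translate φ unplaced , sentence-translate φ ,
  λ ⊨-agree → ⊨-differs (trans (C.⊨-translate φ) (trans ⊨-agree (sym (C'.⊨-translate φ))))
  where
  open Translation B {k}
  module C  = Correctness A  B {k}
  module C' = Correctness A' B {k}

lemma5p1 : (A A' B : Graph) (w w' : ℕ∞) →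
    IsW (A ⋆ B) (A' ⋆ B) w → IsW A A' w' → w' ≤∞ w
lemma5p1 A A' B (fin m) (fin m') (dist , _) (_ , minimal) =
  fin≤fin (minimal m (distinguishable-⋆ A A' B m dist))
lemma5p1 A A' B (fin m) ∞        (dist , _) indist        =
  ⊥-elim (indist m (distinguishable-⋆ A A' B m dist))
lemma5p1 A A' B ∞       w'       _          _             = w' ≤∞∞
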